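{- Let $T$ be a tournament. If $\tau(T)=\{a,b,c\}$ (a set of three vertices), then $\{a,b,c\}$ is the unique minimal $\tau$-retentive set of $T$.
   Context: A tournament $T$ consists of a finite vertex set $V(T)$ and an asymmetric, complete binary relation $\succ$ on $V(T)$ ($x$ dominates $y$ if $x\succ y$). For $v\in V(T)$ let $N^-_T(v)=\{u: u\succ v\}$; for $B\subseteq V(T)$, $T[B]$ is the induced subtournament. The tournament equilibrium set $\tau$ is defined recursively: a nonempty $A\subseteq V(T)$ is $\tau$-retentive if for every $x\in A$ with $N^-_T(x)\neq\emptyset$, $\tau(T[N^-_T(x)])\subseteq A$; $A$ is a minimal $\tau$-retentive set if no $\tau$-retentive set of $T$ is a proper subset of $A$; $\tau(T)$ is the union of all minimal $\tau$-retentive sets of $T$. -}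

module Defs where

open import Data.Nat using (ℕ; zero; suc)
open import Data.Fin using (Fin)
open import Data.Fin.Subset using (Subset; _∈_; _⊆_; _⊂_; Nonempty; ⊥; ⊤)
open import Data.Fin.Subset.Properties using (_∈?_; _⊆?_; _⊂?_; nonempty?)
open import Data.Fin.Properties using (all?)
open import Data.Vec using (Vec; []; _∷_; tabulate)
open import Data.Bool using (Bool; true; false)
open import Data.Product using (Σ; ∃; _×_; _,_)
open import Data.Sum using (_⊎_; inj₁; inj₂)
open import Relation.Nullary using (¬_; Dec; yes; no; does)
open import Relation.Nullary.Decidable using (_×-dec_; _→-dec_; ¬?)
open import Relation.Binary.PropositionalEquality using (_≡_; _≢_)

-- The relation is required to be decidable (automatic classically for a
-- finite relation; needed constructively to compute τ).
record Tournament (n : ℕ) : Set₁ where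
  field
    _≻_      : Fin n → Fin n → Set
    _≻?_     : ∀ x y → Dec (x ≻ y)
    asym     : ∀ {x y} → x ≻ y → ¬ (y ≻ x)
    complete : ∀ {x y} → x ≢ y → (x ≻ y) ⊎ (y ≻ x)

anySubset? : ∀ {n} {P : Subset n → Set} → (∀ A → Dec (P A)) → Dec (∃ P)
anySubset? {zero}  {P} P? with P? []
... | yes p = yes ([] , p)
... | no ¬p = no λ { ([] , p) → ¬p p }
anySubset? {suc n} {P} P? with anySubset? {n} (λ A → P? (true ∷ A))
... | yes (A , p) = yes (true ∷ A , p)
... | no ¬t with anySubset? {n} (λ A → P? (false ∷ A))
...   | yes (A , p) = yes (false ∷ A , p)
...   | no ¬f = no λ { (true ∷ A , p) → ¬t (A , p) ; (false ∷ A , p) → ¬f (A , p) }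

module _ {n : ℕ} (T : Tournament n) where
  open Tournament T

  -- In-neighbourhood of x inside the subtournament T[B]:
  -- N⁻_{T[B]}(x) = { u ∈ B : u ≻ x }.  (T[B][N⁻] = T[N⁻] as induced subtournaments.)
  Nin : Subset n → Fin n → Subset n
  Nin B x = tabulate λ u → does ((u ∈? B) ×-dec (u ≻? x))

  -- Given a choice rule f (f C meant as "τ(T[C])"), A is f-retentive in T[B].
  Retentive : (Subset n → Subset n) → Subset n → Subset n → Set
  Retentive f B A =
    A ⊆ B × Nonempty A ×
    (∀ x → x ∈ A → Nonempty (Nin B x) → f (Nin B x) ⊆ A)

  MinimalRetentive : (Subset n → Subset n) → Subset n → Subset n → Set
  MinimalRetentive f B A =
    Retentive f B A × ¬ (∃ λ A′ → Retentive f B A′ × A′ ⊂ A)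

  retentive? : ∀ f B A → Dec (Retentive f B A)
  retentive? f B A =
    (A ⊆? B) ×-dec (nonempty? A ×-dec
      all? (λ x → (x ∈? A) →-dec (nonempty? (Nin B x) →-dec (f (Nin B x) ⊆? A))))

  minimalRetentive? : ∀ f B A → Dec (MinimalRetentive f B A)
  minimalRetentive? f B A =
    retentive? f B A ×-dec ¬? (anySubset? λ A′ → retentive? f B A′ ×-dec (A′ ⊂? A))

  -- τ with fuel: τ-fuel k B is τ(T[B]) whenever k ≥ |B| (recursive calls
  -- are on in-neighbourhoods, which are strictly smaller).
  -- τ(T[B]) = union of all minimal τ-retentive sets of T[B].
  τ-fuel : ℕ → Subset n → Subset n
  τ-fuel zero    B = ⊥
  τ-fuel (suc k) B =
    tabulate λ x → does (anySubset? λ A → minimalRetentive? (τ-fuel k) B A ×-dec (x ∈? A))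

  τ : Subset n → Subset n
  τ B = τ-fuel n B

  TauRetentive : Subset n → Set
  TauRetentive A = Retentive τ ⊤ A

  MinimalTauRetentive : Subset n → Set
  MinimalTauRetentive A = MinimalRetentive τ ⊤ A

-- Every minimal τ-retentive set A lies in τ(T) = {a, b, c}.  No vertex x is undominated:
-- x would lie in τ of the in-neighbourhood of every other vertex, so a minimal
-- τ-retentive set containing some y ≠ x would retain x and properly contain the
-- retentive set {x}; then τ(T) = {x}.  So every member of A has a nonempty
-- in-neighbourhood, whose τ is nonempty and contained in A.  Following in-neighbours
-- twice gives x₂ ≻ x₁ ≻ x₀ in A, pairwise distinct by asymmetry, hence A = {a, b, c}.
module Submission where

open import Defs
open import Data.Nat using (ℕ; zero; suc; _≤_; _<_)
open import Data.Nat.Properties using (≤-trans; ≤-pred; <⇒≱)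
open import Data.Fin using (Fin; _≟_)
open import Data.Fin.Subset using (Subset; ⁅_⁆; _∪_; ⊤; _∈_; _⊆_; _⊂_; Nonempty; ∣_∣)
open import Data.Fin.Subset.Properties
  using (_∈?_; _⊂?_; nonempty?; ∉⊥; ∈⊤; ∣⊥∣≡0; ∣p∣≤n; p⊂q⇒∣p∣<∣q∣; x∈⁅x⁆; x∈⁅y⁆⇒x≡y;
         x∈p∪q⁻; x∈p∪q⁺; ⊆-refl; ⊆-trans; ⊆-antisym)
open import Data.Fin.Subset.Induction using (Acc; acc; ⊂-wellFounded)
open import Data.Vec using (tabulate)
open import Data.Vec.Properties using (lookup∘tabulate; []=⇒lookup; lookup⇒[]=; tabulate-cong)
open import Data.Product using (_×_; _,_; ∃; proj₁; proj₂)
import Data.Product as Product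
open import Data.Sum using (_⊎_; inj₁; inj₂; [_,_]′)
import Data.Sum as Sum
open import Data.Empty using (⊥-elim) renaming (⊥ to Empty)
open import Function using (_∘_)
open import Function.Bundles using (mk⇔)
open import Relation.Nullary using (¬_; Dec; yes; no; does)
open import Relation.Nullary.Decidable using (_×-dec_; dec-true; does-⇔)
open import Relation.Binary.PropositionalEquality

module _ {X : Set} where

  OneOf : X → X → X → X → Set
  OneOf a b c x = x ≡ a ⊎ x ≡ b ⊎ x ≡ c

  private
    variable
      x y z v a b c : X

  no-three-distinct-in-pair : x ≢ y → y ≢ z → x ≢ z →
                              x ≡ a ⊎ x ≡ b → y ≡ a ⊎ y ≡ b → z ≡ a ⊎ z ≡ b → Empty
  no-three-distinct-in-pair x≢y _   _   (inj₁ refl) (inj₁ refl) _           = x≢y refl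
  no-three-distinct-in-pair x≢y _   _   (inj₂ refl) (inj₂ refl) _           = x≢y refl
  no-three-distinct-in-pair _   _   x≢z (inj₁ refl) (inj₂ refl) (inj₁ refl) = x≢z refl
  no-three-distinct-in-pair _   y≢z _   (inj₁ refl) (inj₂ refl) (inj₂ refl) = y≢z refl
  no-three-distinct-in-pair _   y≢z _   (inj₂ refl) (inj₁ refl) (inj₁ refl) = y≢z refl
  no-three-distinct-in-pair _   _   x≢z (inj₂ refl) (inj₁ refl) (inj₂ refl) = x≢z refl

  first-of-three-hit : x ≢ y → y ≢ z → x ≢ z →
                       OneOf a b c x → OneOf a b c y → OneOf a b c z → OneOf x y z a
  first-of-three-hit _ _ _ (inj₁ refl) _ _ = inj₁ refl
  first-of-three-hit _ _ _ _ (inj₁ refl) _ = inj₂ (inj₁ refl)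
  first-of-three-hit _ _ _ _ _ (inj₁ refl) = inj₂ (inj₂ refl)
  first-of-three-hit x≢y y≢z x≢z (inj₂ x∈bc) (inj₂ y∈bc) (inj₂ z∈bc) =
    ⊥-elim (no-three-distinct-in-pair x≢y y≢z x≢z x∈bc y∈bc z∈bc)

  rotate : OneOf a b c x → OneOf b c a x
  rotate = [ inj₂ ∘ inj₂ , Sum.map₂ inj₁ ]′

  distinct-triple-covers : x ≢ y → y ≢ z → x ≢ z →
                           OneOf a b c x → OneOf a b c y → OneOf a b c z →
                           OneOf a b c v → OneOf x y z v
  distinct-triple-covers x≢y y≢z x≢z x′ y′ z′ (inj₁ refl) =
    first-of-three-hit x≢y y≢z x≢z x′ y′ z′
  distinct-triple-covers x≢y y≢z x≢z x′ y′ z′ (inj₂ (inj₁ refl)) =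
    first-of-three-hit x≢y y≢z x≢z (rotate x′) (rotate y′) (rotate z′)
  distinct-triple-covers x≢y y≢z x≢z x′ y′ z′ (inj₂ (inj₂ refl)) =
    first-of-three-hit x≢y y≢z x≢z (rotate (rotate x′)) (rotate (rotate y′)) (rotate (rotate z′))

private
  variable
    n : ℕ

∈-tabulate-does⁻ : {P : Fin n → Set} (P? : ∀ x → Dec (P x)) {x : Fin n} →
                   x ∈ tabulate (λ y → does (P? y)) → P x
∈-tabulate-does⁻ P? {x} x∈ with P? x | trans (sym (lookup∘tabulate _ x)) ([]=⇒lookup x∈)
... | yes px | _ = px
... | no _   | ()

∈-tabulate-does⁺ : {P : Fin n → Set} (P? : ∀ x → Dec (P x)) {x : Fin n} →
                   P x → x ∈ tabulate (λ y → does (P? y))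
∈-tabulate-does⁺ P? {x} px = lookup⇒[]= x _ (trans (lookup∘tabulate _ x) (dec-true (P? x) px))

Nonempty⇒0<∣p∣ : {p : Subset n} → Nonempty p → 0 < ∣ p ∣
Nonempty⇒0<∣p∣ {n} {p} (x , x∈p) =
  subst (_< ∣ p ∣) (∣⊥∣≡0 n) (p⊂q⇒∣p∣<∣q∣ ((λ x∈⊥ → ⊥-elim (∉⊥ x∈⊥)) , x , x∈p , ∉⊥))

⊂⁅x⁆⇒empty : {A : Subset n} {x : Fin n} → A ⊂ ⁅ x ⁆ → ¬ Nonempty A
⊂⁅x⁆⇒empty {x = x} (A⊆⁅x⁆ , z , z∈⁅x⁆ , z∉A) (y , y∈A) =
  z∉A (subst (_∈ _) (trans (x∈⁅y⁆⇒x≡y x (A⊆⁅x⁆ y∈A)) (sym (x∈⁅y⁆⇒x≡y x z∈⁅x⁆))) y∈A)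

∈-triple⁻ : {a b c x : Fin n} → x ∈ ⁅ a ⁆ ∪ ⁅ b ⁆ ∪ ⁅ c ⁆ → OneOf a b c x
∈-triple⁻ {a = a} {b} {c} =
  Sum.map (x∈⁅y⁆⇒x≡y a) (Sum.map (x∈⁅y⁆⇒x≡y b) (x∈⁅y⁆⇒x≡y c) ∘ x∈p∪q⁻ _ _) ∘ x∈p∪q⁻ _ _

∈-triple⁺ : {a b c x : Fin n} → OneOf a b c x → x ∈ ⁅ a ⁆ ∪ ⁅ b ⁆ ∪ ⁅ c ⁆
∈-triple⁺ = x∈p∪q⁺ ∘ Sum.map ∈⁅⁆ (x∈p∪q⁺ ∘ Sum.map ∈⁅⁆ ∈⁅⁆)
  where
  ∈⁅⁆ : {x y : Fin n} → x ≡ y → x ∈ ⁅ y ⁆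
  ∈⁅⁆ refl = x∈⁅x⁆ _

triple⊆ : {A : Subset n} {x y z : Fin n} → x ∈ A → y ∈ A → z ∈ A → ⁅ x ⁆ ∪ ⁅ y ⁆ ∪ ⁅ z ⁆ ⊆ A
triple⊆ x∈A y∈A z∈A v∈ with ∈-triple⁻ v∈
... | inj₁ refl        = x∈A
... | inj₂ (inj₁ refl) = y∈A
... | inj₂ (inj₂ refl) = z∈A

triple⊆distinct-triple : {a b c x y z : Fin n} → x ≢ y → y ≢ z → x ≢ z →
  x ∈ ⁅ a ⁆ ∪ ⁅ b ⁆ ∪ ⁅ c ⁆ → y ∈ ⁅ a ⁆ ∪ ⁅ b ⁆ ∪ ⁅ c ⁆ → z ∈ ⁅ a ⁆ ∪ ⁅ b ⁆ ∪ ⁅ c ⁆ →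
  ⁅ a ⁆ ∪ ⁅ b ⁆ ∪ ⁅ c ⁆ ⊆ ⁅ x ⁆ ∪ ⁅ y ⁆ ∪ ⁅ z ⁆
triple⊆distinct-triple x≢y y≢z x≢z x∈ y∈ z∈ =
  ∈-triple⁺ ∘ distinct-triple-covers x≢y y≢z x≢z (∈-triple⁻ x∈) (∈-triple⁻ y∈) (∈-triple⁻ z∈)
            ∘ ∈-triple⁻

module _ {n : ℕ} (T : Tournament n) where
  open Tournament T

  private
    variable
      A B C : Subset n
      f g : Subset n → Subset n
      k : ℕ
      x y z : Fin n

  irreflexive : ¬ (x ≻ x)
  irreflexive x≻x = asym x≻x x≻x

  ∈-Nin⁻ : y ∈ Nin T B x → y ∈ B × y ≻ x
  ∈-Nin⁻ {B = B} {x = x} = ∈-tabulate-does⁻ (λ u → (u ∈? B) ×-dec (u ≻? x))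

  ∈-Nin⁺ : y ∈ B → y ≻ x → y ∈ Nin T B x
  ∈-Nin⁺ {B = B} {x = x} y∈B y≻x = ∈-tabulate-does⁺ (λ u → (u ∈? B) ×-dec (u ≻? x)) (y∈B , y≻x)

  ≻⇒≢ : x ≻ y → y ≢ x
  ≻⇒≢ x≻y refl = irreflexive x≻y

  ≻-≻⇒≢ : z ≻ y → y ≻ x → x ≢ z
  ≻-≻⇒≢ z≻y y≻x refl = asym y≻x z≻y

  Nin⊆ : Nin T B x ⊆ B
  Nin⊆ = proj₁ ∘ ∈-Nin⁻

  Nin⊂ : x ∈ B → Nin T B x ⊂ B
  Nin⊂ {x = x} x∈B = Nin⊆ , x , x∈B , irreflexive ∘ proj₂ ∘ ∈-Nin⁻

  Nin-mono : B ⊆ C → Nin T B x ⊆ Nin T C x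
  Nin-mono B⊆C y∈ = let y∈B , y≻x = ∈-Nin⁻ y∈ in ∈-Nin⁺ (B⊆C y∈B) y≻x

  MinimalContaining : (Subset n → Subset n) → Subset n → Fin n → Set
  MinimalContaining f B x = ∃ λ A → MinimalRetentive T f B A × x ∈ A

  minimalContaining? : ∀ f B x → Dec (MinimalContaining f B x)
  minimalContaining? f B x = anySubset? λ A → minimalRetentive? T f B A ×-dec (x ∈? A)

  ∈-τ-fuel-suc⁻ : x ∈ τ-fuel T (suc k) B → MinimalContaining (τ-fuel T k) B x
  ∈-τ-fuel-suc⁻ {k = k} {B = B} = ∈-tabulate-does⁻ (minimalContaining? (τ-fuel T k) B)

  ∈-τ-fuel-suc⁺ : MinimalRetentive T (τ-fuel T k) B A → x ∈ A → x ∈ τ-fuel T (suc k) B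
  ∈-τ-fuel-suc⁺ {k = k} {B = B} {A = A} min x∈A =
    ∈-tabulate-does⁺ (minimalContaining? (τ-fuel T k) B) (A , min , x∈A)

  τ-fuel⊆ : ∀ k → τ-fuel T k B ⊆ B
  τ-fuel⊆ zero    x∈⊥ = ⊥-elim (∉⊥ x∈⊥)
  τ-fuel⊆ (suc k) x∈  = let _ , ((A⊆B , _) , _) , x∈A = ∈-τ-fuel-suc⁻ {k = k} x∈ in A⊆B x∈A

  record AgreeOnNin (f g : Subset n → Subset n) (B : Subset n) : Set where
    constructor agreeOnNin
    field
      agreeAt : ∀ x → x ∈ B → Nonempty (Nin T B x) → f (Nin T B x) ≡ g (Nin T B x)

  AgreeOnNin-sym : AgreeOnNin f g B → AgreeOnNin g f B
  AgreeOnNin-sym (agreeOnNin f≈g) = agreeOnNin λ x x∈B ne → sym (f≈g x x∈B ne)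

  Retentive-cong : AgreeOnNin f g B → Retentive T f B A → Retentive T g B A
  Retentive-cong {A = A} (agreeOnNin f≈g) (A⊆B , ne , closed) =
    A⊆B , ne , λ x x∈A nx → subst (_⊆ A) (f≈g x (A⊆B x∈A) nx) (closed x x∈A nx)

  MinimalRetentive-cong : AgreeOnNin f g B → MinimalRetentive T f B A → MinimalRetentive T g B A
  MinimalRetentive-cong f≈g (ret , minimal) =
    Retentive-cong f≈g ret ,
    λ (A′ , ret′ , A′⊂A) → minimal (A′ , Retentive-cong (AgreeOnNin-sym f≈g) ret′ , A′⊂A)

  τ-fuel-stable : ∀ k {D} → Nonempty D → ∣ D ∣ ≤ k → τ-fuel T k D ≡ τ-fuel T (suc k) D
  τ-fuel-stable zero    ne ∣D∣≤0 = ⊥-elim (<⇒≱ (Nonempty⇒0<∣p∣ ne) ∣D∣≤0)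
  τ-fuel-stable (suc k) {D} _ ∣D∣≤1+k = tabulate-cong λ x →
    does-⇔ (mk⇔ (transfer agree) (transfer (AgreeOnNin-sym agree)))
           (minimalContaining? (τ-fuel T k) D x) (minimalContaining? (τ-fuel T (suc k)) D x)
    where
    agree : AgreeOnNin (τ-fuel T k) (τ-fuel T (suc k)) D
    agree = agreeOnNin λ y y∈D ne →
      τ-fuel-stable k ne (≤-pred (≤-trans (p⊂q⇒∣p∣<∣q∣ (Nin⊂ y∈D)) ∣D∣≤1+k))
    transfer : AgreeOnNin f g D → MinimalContaining f D x → MinimalContaining g D x
    transfer f≈g = Product.map₂ (Product.map₁ (MinimalRetentive-cong f≈g))

  minimalRetentive-exists : Retentive T f B A → ∃ (MinimalRetentive T f B)
  minimalRetentive-exists {f = f} {B = B} = descend (⊂-wellFounded _)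
    where
    descend : ∀ {A} → Acc _⊂_ A → Retentive T f B A → ∃ (MinimalRetentive T f B)
    descend {A} (acc smaller) ret with anySubset? (λ A′ → retentive? T f B A′ ×-dec (A′ ⊂? A))
    ... | yes (A′ , ret′ , A′⊂A) = descend (smaller A′⊂A) ret′
    ... | no none                 = A , ret , none

  τ≡τ-fuel-suc : Nonempty B → τ T B ≡ τ-fuel T (suc n) B
  τ≡τ-fuel-suc {B = B} ne = τ-fuel-stable n ne (∣p∣≤n B)

  τ⊆ : τ T B ⊆ B
  τ⊆ = τ-fuel⊆ n

  ∈-τ⁻ : x ∈ τ T B → MinimalContaining (τ T) B x
  ∈-τ⁻ {x = x} x∈ = ∈-τ-fuel-suc⁻ {k = n} (subst (x ∈_) (τ≡τ-fuel-suc (x , τ⊆ x∈)) x∈)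

  ∈-τ⁺ : MinimalRetentive T (τ T) B A → x ∈ A → x ∈ τ T B
  ∈-τ⁺ {x = x} min@((A⊆B , _) , _) x∈A =
    subst (x ∈_) (sym (τ≡τ-fuel-suc (x , A⊆B x∈A))) (∈-τ-fuel-suc⁺ {k = n} min x∈A)

  τ-nonempty : Nonempty B → Nonempty (τ T B)
  τ-nonempty ne with minimalRetentive-exists {f = τ T} (⊆-refl , ne , λ _ _ _ → Nin⊆ ∘ τ⊆)
  ... | _ , min@((_ , (x , x∈A) , _) , _) = x , ∈-τ⁺ min x∈A

  singleton-minimal : x ∈ B → ¬ Nonempty (Nin T B x) → MinimalRetentive T f B ⁅ x ⁆
  singleton-minimal {x = x} {B = B} x∈B undominated =
    ((λ y∈⁅x⁆ → subst (_∈ B) (sym (x∈⁅y⁆⇒x≡y x y∈⁅x⁆)) x∈B) ,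
     (x , x∈⁅x⁆ x) ,
     λ y y∈⁅x⁆ ne → ⊥-elim (undominated (subst (Nonempty ∘ Nin T B) (x∈⁅y⁆⇒x≡y x y∈⁅x⁆) ne))) ,
    λ (_ , (_ , ne , _) , A′⊂⁅x⁆) → ⊂⁅x⁆⇒empty A′⊂⁅x⁆ ne

  undominated⇒∈τ : x ∈ B → ¬ Nonempty (Nin T B x) → x ∈ τ T B
  undominated⇒∈τ x∈B undominated = ∈-τ⁺ (singleton-minimal {f = τ T} x∈B undominated) (x∈⁅x⁆ _)

  undominated⇒τ⊆⁅x⁆ : x ∈ B → ¬ Nonempty (Nin T B x) → τ T B ⊆ ⁅ x ⁆
  undominated⇒τ⊆⁅x⁆ {x = x} {B = B} x∈B undominated {y} y∈τ with ∈-τ⁻ y∈τ | y ≟ x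
  ... | _ | yes refl = x∈⁅x⁆ x
  ... | A , ((A⊆B , _ , closed) , minimal) , y∈A | no y≢x =
    ⊥-elim (minimal (⁅ x ⁆ , proj₁ (singleton-minimal {f = τ T} x∈B undominated) , ⁅x⁆⊂A))
    where
    x≻y : x ≻ y
    x≻y = [ (λ x≻y → x≻y) , (λ y≻x → ⊥-elim (undominated (y , ∈-Nin⁺ (A⊆B y∈A) y≻x))) ]′
            (complete (y≢x ∘ sym))
    x∈Nin : x ∈ Nin T B y
    x∈Nin = ∈-Nin⁺ x∈B x≻y
    x∈A : x ∈ A
    x∈A = closed y y∈A (x , x∈Nin)
            (undominated⇒∈τ x∈Nin (undominated ∘ Product.map₂ (Nin-mono Nin⊆)))
    ⁅x⁆⊂A : ⁅ x ⁆ ⊂ A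
    ⁅x⁆⊂A = (λ z∈⁅x⁆ → subst (_∈ A) (sym (x∈⁅y⁆⇒x≡y x z∈⁅x⁆)) x∈A) , y , y∈A , y≢x ∘ x∈⁅y⁆⇒x≡y x

  DominatedWithin : Subset n → Set
  DominatedWithin A = ∀ x → x ∈ A → ∃ λ y → y ∈ A × y ≻ x

  retentive⇒dominatedWithin : (∀ x → x ∈ A → Nonempty (Nin T B x)) → Retentive T (τ T) B A →
                              DominatedWithin A
  retentive⇒dominatedWithin dominated (_ , _ , closed) x x∈A =
    let y , y∈τ = τ-nonempty (dominated x x∈A)
    in  y , closed x x∈A (dominated x x∈A) y∈τ , proj₂ (∈-Nin⁻ (τ⊆ y∈τ))

  dominatedWithin⇒triple⊆ : {a b c : Fin n} → A ⊆ ⁅ a ⁆ ∪ ⁅ b ⁆ ∪ ⁅ c ⁆ → Nonempty A →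
                            DominatedWithin A → ⁅ a ⁆ ∪ ⁅ b ⁆ ∪ ⁅ c ⁆ ⊆ A
  dominatedWithin⇒triple⊆ A⊆U (x , x∈A) dominated =
    let y , y∈A , y≻x = dominated x x∈A
        z , z∈A , z≻y = dominated y y∈A
    in  ⊆-trans (triple⊆distinct-triple (≻⇒≢ y≻x) (≻⇒≢ z≻y) (≻-≻⇒≢ z≻y y≻x)
                                        (A⊆U x∈A) (A⊆U y∈A) (A⊆U z∈A))
                (triple⊆ x∈A y∈A z∈A)

lemma10 : ∀ {n} (T : Tournament n) (a b c : Fin n) →
    a ≢ b → a ≢ c → b ≢ c →
    τ T ⊤ ≡ ⁅ a ⁆ ∪ ⁅ b ⁆ ∪ ⁅ c ⁆ →
    MinimalTauRetentive T (⁅ a ⁆ ∪ ⁅ b ⁆ ∪ ⁅ c ⁆) ×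
    (∀ A → MinimalTauRetentive T A → A ≡ ⁅ a ⁆ ∪ ⁅ b ⁆ ∪ ⁅ c ⁆)
lemma10 T a b c a≢b _ _ τ≡U =
  let A , minA , _ = ∈-τ⁻ T (∈τ (inj₁ refl))
  in  subst (MinimalTauRetentive T) (minimal⇒≡U A minA) minA , minimal⇒≡U
  where
  U = ⁅ a ⁆ ∪ ⁅ b ⁆ ∪ ⁅ c ⁆

  ∈τ : ∀ {x} → OneOf a b c x → x ∈ τ T ⊤
  ∈τ x∈U = subst (_ ∈_) (sym τ≡U) (∈-triple⁺ x∈U)

  minimal⊆U : ∀ {A} → MinimalTauRetentive T A → A ⊆ U
  minimal⊆U min x∈A = subst (_ ∈_) τ≡U (∈-τ⁺ T min x∈A)

  dominated : ∀ x → Nonempty (Nin T ⊤ x)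
  dominated x with nonempty? (Nin T ⊤ x)
  ... | yes ne = ne
  ... | no undominated = ⊥-elim (a≢b (trans (≡x (inj₁ refl)) (sym (≡x (inj₂ (inj₁ refl))))))
    where
    ≡x : ∀ {v} → OneOf a b c v → v ≡ x
    ≡x = x∈⁅y⁆⇒x≡y x ∘ undominated⇒τ⊆⁅x⁆ T ∈⊤ undominated ∘ ∈τ

  minimal⇒≡U : ∀ A → MinimalTauRetentive T A → A ≡ U
  minimal⇒≡U A min@(ret@(_ , ne , _) , _) =
    ⊆-antisym (minimal⊆U min)
              (dominatedWithin⇒triple⊆ T (minimal⊆U min) ne
                                       (retentive⇒dominatedWithin T (λ x _ → dominated x) ret))
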